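{- Let $n\ge1$, $1\le i\le n$, $m\ge1$, $A\in B^{i,m}$ and $1\le s<i$. Let $1\le k<\ell^A(s)$. Then for every integer $0\le x<x^A(s,r^A(s,k))$ and every $r$ with $r^A(s,k)<r\le n$, $$S^A(s,r)+\sum_{p=i}^{r^A(s,k-1)}x^A(s,p)+x<M^A(s).$$
   Context: $B^{i,m}$ is the set of arrays $A=(a_{p,q})$ of non-negative integers indexed by $1\le p\le i$, $i\le q\le n$, with $\sum_{r=1}^n a_{\beta(r)}\le m$ for every Dyck path $\beta$ (a sequence of positions $\beta(1)=(1,i),\dots,\beta(n)=(i,n)$ with $\beta(r+1)\in\{(a,b+1),(a+1,b)\}$ if $\beta(r)=(a,b)$); $a_{p,q}=0$ outside this range. For $1\le s<i\le r\le n$, the step path $p_{s,r}$ is the set of positions $(s,i),(s,i+1),\dots,(s,r),(s+1,r),(s+1,r+1),\dots,(s+1,n)$; $S^A(s,r)=\sum_{x\in p_{s,r}}a_x$ and $M^A(s)=\max\{S^A(s,r):i\le r\le n\}$. Define $r^A(s,0)=i-1$ and recursively $r^A(s,k+1)=\max\{r>r^A(s,k): S^A(s,r)=\max\{S^A(s,p):r^A(s,k)<p\le n\}\}$, and let $\ell^A(s)$ be the index with $r^A(s,\ell^A(s))=n$. Define integers $x^A(s,r)$, $i\le r\le n$: $x^A(s,r)=0$ if $r\notin\{r^A(s,1),\dots,r^A(s,\ell^A(s))\}$; $x^A(s,n)=a_{s+1,n}$; and for $1\le k<\ell^A(s)$, $x^A(s,r^A(s,k))$ is determined recursively by $S^A(s,r^A(s,k+1))+\sum_{p=i}^{r^A(s,k)}x^A(s,p)=M^A(s)$.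 -}

module Defs where

open import Data.Nat using (ℕ; zero; suc; _+_; _∸_; _⊔_; _≤_; _<_; _≟_; _≡ᵇ_; _≤ᵇ_)
open import Data.Integer as ℤ using (ℤ; +_)
open import Data.List using (List; []; _∷_; map; foldr; filter; upTo)
open import Data.Nat.ListAction using (sum)
open import Data.Maybe using (Maybe; just; nothing)
open import Data.Bool using (if_then_else_)
open import Data.Product using (_×_; _,_)
open import Relation.Binary.PropositionalEquality using (_≡_)
open import Data.Sum using (_⊎_)
open import Relation.Nullary using (¬_)

Arr : Set
Arr = ℕ → ℕ → ℕ

-- the list [a, a+1, ..., b]  (empty if b < a)
range : ℕ → ℕ → List ℕ
range a b = map (λ t → a + t) (upTo (suc b ∸ a))

sumN : ℕ → ℕ → (ℕ → ℕ) → ℕ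
sumN a b f = sum (map f (range a b))

sumZ : ℕ → ℕ → (ℕ → ℤ) → ℤ
sumZ a b f = foldr ℤ._+_ (+ 0) (map f (range a b))

-- max_{a ≤ q ≤ b} f q  (0 for an empty range; all values are ≥ 0)
maxN : ℕ → ℕ → (ℕ → ℕ) → ℕ
maxN a b f = foldr _⊔_ 0 (map f (range a b))

record DyckPath (n i : ℕ) (β : ℕ → ℕ × ℕ) : Set where
  field
    start : β 1 ≡ (1 , i)
    end   : β n ≡ (i , n)
    step  : ∀ r → 1 ≤ r → r < n →
            ∀ a b → β r ≡ (a , b) →
            (β (suc r) ≡ (a , suc b)) ⊎ (β (suc r) ≡ (suc a , b))

at : Arr → ℕ × ℕ → ℕ
at A (p , q) = A p q

record InB (n i m : ℕ) (A : Arr) : Set where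
  field
    support : ∀ p q → ¬ ((1 ≤ p × p ≤ i) × (i ≤ q × q ≤ n)) → A p q ≡ 0
    dyck    : ∀ β → DyckPath n i β → sumN 1 n (λ r → at A (β r)) ≤ m

module _ (n i : ℕ) (A : Arr) (s : ℕ) where

  -- S^A(s,r): sum over the step path p_{s,r}
  S : ℕ → ℕ
  S r = sumN i r (A s) + sumN r n (A (suc s))

  M : ℕ
  M = maxN i n S

  nextR : ℕ → ℕ
  nextR a = foldr _⊔_ 0 (filter (λ p → S p ≟ mv) (range (suc a) n))
    where mv = maxN (suc a) n S

  -- r^A(s,k)   (total; only meaningful for k ≤ ℓ^A(s))
  rA : ℕ → ℕ
  rA zero    = i ∸ 1
  rA (suc k) = nextR (rA k)

  private
    search : ℕ → ℕ → ℕ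
    search zero    k = k
    search (suc f) k = if rA k ≡ᵇ n then k else search f (suc k)

  ℓA : ℕ
  ℓA = search n 0

  idx : ℕ → Maybe ℕ
  idx r with filter (λ k → rA k ≟ r) (range 1 ℓA)
  ... | []    = nothing
  ... | k ∷ _ = just k

  private
    xCase : ℕ → Maybe ℕ → ℤ → ℤ
    xCase r nothing  below = + 0
    xCase r (just k) below =
      if r ≡ᵇ n then + A (suc s) n
      else ((+ M) ℤ.- (+ S (rA (suc k)))) ℤ.- below

  mutual
    xA : ℕ → ℤ
    xA r = xCase r (idx r) (below r)

    below : ℕ → ℤ
    below zero    = + 0
    below (suc r) = below r ℤ.+ (if i ≤ᵇ r then xA r else + 0)

{-# OPTIONS --safe #-}
module Submission where

-- Write a = r(s,k-1), b = r(s,k) and c = r(s,k+1).  Each r(s,j+1) is the last maximiser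
-- of S on (r(s,j), n], so no such index lies strictly between a and b (it would beat S(b)):
-- x^A vanishes on (a, b) and the x^A-sum up to b-1 equals the sum up to a.  Since
-- x^A(s,b) > x ≥ 0, b carries the defining equation x^A(s,b) = M − S(c) − Σ_{p=i}^{a} x^A(s,p),
-- and S(r) ≤ S(c) because c maximises S on (b, n].  The argument does not use A ∈ B^{i,m}.

open import Defs
open import Data.Nat using (ℕ; _≤_; _<_; _∸_)
open import Data.Integer as ℤ using (ℤ; +_)
open import Data.Nat using (zero; suc; _+_; _⊔_; _≟_; _<?_; _≡ᵇ_; _≤ᵇ_; z≤n; s≤s; s≤s⁻¹)
open import Data.Nat.Properties
  using (≤-refl; ≤-trans; <⇒≤; <-trans; <-≤-trans; <⇒≢; <⇒≱; ≰⇒>; ≮⇒≥; ≤∧≢⇒<; m<n⇒m<1+n; n≤0⇒n≡0;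
         m≤m+n; +-monoʳ-<; m∸n≢0⇒n<m; m≤n⇒m∸n≡0; ∸-monoˡ-<; m+[n∸m]≡n; +-∸-assoc;
         m≤m⊔n; m≤n⇒m≤o⊔n; ⊔-sel; ⊔-lub; ≤ᵇ-reflects-≤)
import Data.Integer.Properties as ℤ
open import Data.Integer.Solver using (module +-*-Solver)
open import Data.Bool using (true; false; if_then_else_)
open import Data.Bool.Properties using (if-cong-then; if-eta)
open import Data.Maybe using (just; nothing)
open import Data.Product using (_×_; _,_; proj₁; proj₂; ∃-syntax)
open import Data.Sum using (_⊎_; inj₁; inj₂)
open import Data.Empty using (⊥; ⊥-elim)
open import Data.List using (List; []; _∷_; _∷ʳ_; map; foldr; filter; upTo)
open import Data.List.Properties using (upTo-∷ʳ; map-++; foldr-preservesᵇ)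
open import Data.List.Membership.Propositional using (_∈_)
open import Data.List.Membership.Propositional.Properties
  using (∈-map⁺; ∈-map⁻; ∈-upTo⁺; ∈-upTo⁻; ∈-filter⁺; ∈-filter⁻; foldr-selective)
open import Data.List.Relation.Unary.Any using (here; there)
open import Data.List.Relation.Unary.All as All using (All)
open import Data.List.Relation.Unary.All.Properties using (map⁺)
open import Relation.Nullary.Decidable using (yes; no; dec-false)
open import Relation.Nullary.Reflects using (ofʸ; ofⁿ)
open import Relation.Binary.PropositionalEquality

<⇒≡ᵇ-false : ∀ {m n} → m < n → (m ≡ᵇ n) ≡ false
<⇒≡ᵇ-false {m} {n} m<n = dec-false (m ≟ n) (<⇒≢ m<n)

maxℕ : List ℕ → ℕ
maxℕ = foldr _⊔_ 0

≤-maxℕ : ∀ {x xs} → x ∈ xs → x ≤ maxℕ xs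
≤-maxℕ {xs = y ∷ _} (here refl) = m≤m⊔n y _
≤-maxℕ {xs = y ∷ _} (there x∈) = m≤n⇒m≤o⊔n y (≤-maxℕ x∈)

maxℕ-least : ∀ {b xs} → All (_≤ b) xs → maxℕ xs ≤ b
maxℕ-least = foldr-preservesᵇ ⊔-lub z≤n

maxℕ-∈ : ∀ {x xs} → x ∈ xs → maxℕ xs ∈ xs
maxℕ-∈ {x} {xs} x∈ with foldr-selective ⊔-sel 0 xs
... | inj₂ max∈ = max∈
... | inj₁ max≡0 = subst (_∈ xs) x≡max x∈
  where
  x≡max : x ≡ maxℕ xs
  x≡max = trans (n≤0⇒n≡0 (subst (x ≤_) max≡0 (≤-maxℕ x∈))) (sym max≡0)

∈-range⁺ : ∀ {a b p} → a ≤ p → p ≤ b → p ∈ range a b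
∈-range⁺ {a} {b} a≤p p≤b =
  subst (_∈ range a b) (m+[n∸m]≡n a≤p) (∈-map⁺ (λ t → a + t) (∈-upTo⁺ (∸-monoˡ-< (s≤s p≤b) a≤p)))

∈-range⁻ : ∀ {a b p} → p ∈ range a b → a ≤ p × p ≤ b
∈-range⁻ {a} {b} p∈ with t , t∈ , refl ← ∈-map⁻ (λ t → a + t) p∈ =
  m≤m+n a t , s≤s⁻¹ (subst (a + t <_) (m+[n∸m]≡n a≤1+b) (+-monoʳ-< a t<d))
  where
  t<d : t < suc b ∸ a
  t<d = ∈-upTo⁻ t∈
  a≤1+b : a ≤ suc b
  a≤1+b = <⇒≤ (m∸n≢0⇒n<m (λ d≡0 → <⇒≱ (subst (t <_) d≡0 t<d) z≤n))

-- range a b is halfOpenRange a (suc b) by definition.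
halfOpenRange : ℕ → ℕ → List ℕ
halfOpenRange a m = map (λ t → a + t) (upTo (m ∸ a))

halfOpenRange-empty : ∀ {a m} → m ≤ a → halfOpenRange a m ≡ []
halfOpenRange-empty {a} m≤a = cong (λ d → map (λ t → a + t) (upTo d)) (m≤n⇒m∸n≡0 m≤a)

halfOpenRange-suc : ∀ {a m} → a ≤ m → halfOpenRange a (suc m) ≡ halfOpenRange a m ∷ʳ m
halfOpenRange-suc {a} {m} a≤m = begin
  map shift (upTo (suc m ∸ a))           ≡⟨ cong (λ d → map shift (upTo d)) (+-∸-assoc 1 a≤m) ⟩
  map shift (upTo (suc (m ∸ a)))         ≡⟨ cong (map shift) (upTo-∷ʳ (m ∸ a)) ⟨
  map shift (upTo (m ∸ a) ∷ʳ (m ∸ a))    ≡⟨ map-++ shift (upTo (m ∸ a)) _ ⟩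
  halfOpenRange a m ∷ʳ (a + (m ∸ a))     ≡⟨ cong (halfOpenRange a m ∷ʳ_) (m+[n∸m]≡n a≤m) ⟩
  halfOpenRange a m ∷ʳ m                 ∎
  where
  open ≡-Reasoning
  shift : ℕ → ℕ
  shift t = a + t

sumℤ : (ℕ → ℤ) → List ℕ → ℤ
sumℤ f xs = foldr ℤ._+_ (+ 0) (map f xs)

sumℤ-∷ʳ : ∀ (f : ℕ → ℤ) xs x → sumℤ f (xs ∷ʳ x) ≡ sumℤ f xs ℤ.+ f x
sumℤ-∷ʳ f []       x = trans (ℤ.+-identityʳ (f x)) (sym (ℤ.+-identityˡ (f x)))
sumℤ-∷ʳ f (y ∷ ys) x = trans (cong (ℤ._+_ (f y)) (sumℤ-∷ʳ f ys x)) (sym (ℤ.+-assoc (f y) _ (f x)))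

≤-maxN : ∀ {a b p} (f : ℕ → ℕ) → a ≤ p → p ≤ b → f p ≤ maxN a b f
≤-maxN f a≤p p≤b = ≤-maxℕ (∈-map⁺ f (∈-range⁺ a≤p p≤b))

maxN-least : ∀ {a b c} (f : ℕ → ℕ) → (∀ p → a ≤ p → p ≤ b → f p ≤ c) → maxN a b f ≤ c
maxN-least f bound = maxℕ-least (map⁺ (All.tabulate λ p∈ →
  let a≤p , p≤b = ∈-range⁻ p∈ in bound _ a≤p p≤b))

maxN-attained : ∀ {a b} (f : ℕ → ℕ) → a ≤ b → ∃[ q ] q ∈ range a b × maxN a b f ≡ f q
maxN-attained f a≤b = ∈-map⁻ f (maxℕ-∈ (∈-map⁺ f (∈-range⁺ a≤b ≤-refl)))

record IsLastArgmax (f : ℕ → ℕ) (a n b : ℕ) : Set where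
  field
    lower   : a < b
    upper   : b ≤ n
    maximal : ∀ q → a < q → q ≤ n → f q ≤ f b
    last    : ∀ q → b < q → q ≤ n → f q < f b

lastArgmax-not-inside : ∀ {f a a′ n b p} → IsLastArgmax f a n b → IsLastArgmax f a′ n p →
                        a < p → p < b → ⊥
lastArgmax-not-inside {b = b} {p = p} B P a<p p<b =
  <⇒≱ (IsLastArgmax.last P b p<b (IsLastArgmax.upper B))
      (IsLastArgmax.maximal B p a<p (<⇒≤ (<-≤-trans p<b (IsLastArgmax.upper B))))

r≤c∧x<m-c-z⇒r+z+x<m : ∀ {r c z x m : ℤ} → r ℤ.≤ c → x ℤ.< m ℤ.- c ℤ.- z →
                      r ℤ.+ z ℤ.+ x ℤ.< m
r≤c∧x<m-c-z⇒r+z+x<m {r} {c} {z} {x} {m} r≤c x<m-c-z = begin-strict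
  r ℤ.+ z ℤ.+ x                   ≤⟨ ℤ.+-monoˡ-≤ x (ℤ.+-monoˡ-≤ z r≤c) ⟩
  c ℤ.+ z ℤ.+ x                   <⟨ ℤ.+-monoʳ-< (c ℤ.+ z) x<m-c-z ⟩
  c ℤ.+ z ℤ.+ (m ℤ.- c ℤ.- z)     ≡⟨ solve 3 (λ c z m → c :+ z :+ (m :- c :- z) := m) refl c z m ⟩
  m                               ∎
  where
  open ℤ.≤-Reasoning
  open +-*-Solver

module _ (n i : ℕ) (A : Arr) (s : ℕ) where

  nextR-isLastArgmax : ∀ {a} → a < n → IsLastArgmax (S n i A s) a n (nextR n i A s a)
  nextR-isLastArgmax {a} a<n = record
    { lower = proj₁ (∈-range⁻ b∈range)
    ; upper = proj₂ (∈-range⁻ b∈range)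
    ; maximal = maximal
    ; last = last
    }
    where
    f = S n i A s
    P? = λ p → f p ≟ maxN (suc a) n f
    b = nextR n i A s a
    b∈ : b ∈ filter P? (range (suc a) n)
    b∈ with q , q∈ , max≡fq ← maxN-attained f a<n = maxℕ-∈ (∈-filter⁺ P? q∈ (sym max≡fq))
    b∈range = proj₁ (∈-filter⁻ P? {xs = range (suc a) n} b∈)
    Sb≡max = proj₂ (∈-filter⁻ P? {xs = range (suc a) n} b∈)
    maximal : ∀ q → a < q → q ≤ n → f q ≤ f b
    maximal q a<q q≤n = subst (f q ≤_) (sym Sb≡max) (≤-maxN f a<q q≤n)
    last : ∀ q → b < q → q ≤ n → f q < f b
    last q b<q q≤n = ≤∧≢⇒< (maximal q a<q q≤n) λ fq≡fb →
      <⇒≱ b<q (≤-maxℕ (∈-filter⁺ P? (∈-range⁺ a<q q≤n) (trans fq≡fb Sb≡max)))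
      where a<q = <-trans (proj₁ (∈-range⁻ b∈range)) b<q

  nextR-beyond : ∀ {a} → n ≤ a → nextR n i A s a ≡ 0
  nextR-beyond {a} n≤a =
    cong (λ d → maxℕ (filter P? (map (λ t → suc a + t) (upTo d)))) (m≤n⇒m∸n≡0 n≤a)
    where P? = λ p → S n i A s p ≟ maxN (suc a) n (S n i A s)

  idx-sound : ∀ {r k} → idx n i A s r ≡ just k → rA n i A s k ≡ r × 1 ≤ k
  idx-sound {r} eq with filter (λ k → rA n i A s k ≟ r) (range 1 (ℓA n i A s)) in found
  idx-sound {r} refl | k ∷ _
    with k∈ , rk≡r ← ∈-filter⁻ (λ k → rA n i A s k ≟ r) {xs = range 1 (ℓA n i A s)}
                               (subst (k ∈_) (sym found) (here refl))
    = rk≡r , proj₁ (∈-range⁻ k∈)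

  xA-cases : ∀ {p} → p < n →
    xA n i A s p ≡ + 0 ⊎
    ∃[ j ] nextR n i A s (rA n i A s j) ≡ p ×
           xA n i A s p ≡ (+ M n i A s ℤ.- + S n i A s (nextR n i A s p)) ℤ.- below n i A s p
  xA-cases {p} p<n with idx n i A s p in eq
  ... | nothing = inj₁ refl
  ... | just zero with () ← proj₂ (idx-sound eq)
  ... | just (suc j) with rj≡p , _ ← idx-sound eq rewrite rj≡p | <⇒≡ᵇ-false p<n =
    inj₂ (j , rj≡p , refl)

  below≡sumℤ : ∀ m → below n i A s m ≡ sumℤ (xA n i A s) (halfOpenRange i m)
  below≡sumℤ zero = cong (sumℤ (xA n i A s)) (sym (halfOpenRange-empty {i} z≤n))
  below≡sumℤ (suc m) with i ≤ᵇ m | ≤ᵇ-reflects-≤ i m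
  ... | true  | ofʸ i≤m = begin
    below n i A s m ℤ.+ x m              ≡⟨ cong (ℤ._+ x m) (below≡sumℤ m) ⟩
    sumℤ x (halfOpenRange i m) ℤ.+ x m   ≡⟨ sumℤ-∷ʳ x (halfOpenRange i m) m ⟨
    sumℤ x (halfOpenRange i m ∷ʳ m)      ≡⟨ cong (sumℤ x) (halfOpenRange-suc i≤m) ⟨
    sumℤ x (halfOpenRange i (suc m))     ∎
    where
    open ≡-Reasoning
    x = xA n i A s
  ... | false | ofⁿ i≰m = begin
    below n i A s m ℤ.+ + 0              ≡⟨ ℤ.+-identityʳ _ ⟩
    below n i A s m                      ≡⟨ below≡sumℤ m ⟩
    sumℤ x (halfOpenRange i m)           ≡⟨ cong (sumℤ x) (halfOpenRange-empty (<⇒≤ m<i)) ⟩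
    + 0                                  ≡⟨ cong (sumℤ x) (halfOpenRange-empty m<i) ⟨
    sumℤ x (halfOpenRange i (suc m))     ∎
    where
    open ≡-Reasoning
    x = xA n i A s
    m<i = ≰⇒> i≰m

  below-skip : ∀ {a b} → a < b → (∀ p → a < p → p < b → xA n i A s p ≡ + 0) →
               below n i A s b ≡ below n i A s (suc a)
  below-skip {a} {suc b} a<1+b vanish with a ≟ b
  ... | yes refl = refl
  ... | no a≢b = begin
    below n i A s b ℤ.+ (if i ≤ᵇ b then xA n i A s b else + 0)
      ≡⟨ cong₂ ℤ._+_ (below-skip a<b λ p a<p p<b → vanish p a<p (m<n⇒m<1+n p<b))
                     (trans (if-cong-then (i ≤ᵇ b) (vanish b a<b ≤-refl)) (if-eta (i ≤ᵇ b))) ⟩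
    below n i A s (suc a) ℤ.+ + 0
      ≡⟨ ℤ.+-identityʳ _ ⟩
    below n i A s (suc a) ∎
    where
    open ≡-Reasoning
    a<b = ≤∧≢⇒< (s≤s⁻¹ a<1+b) a≢b

  xA-vanishes-inside : ∀ {a} → a < n → ∀ p → a < p → p < nextR n i A s a → xA n i A s p ≡ + 0
  xA-vanishes-inside {a} a<n p a<p p<b
    with xA-cases (<-≤-trans p<b (IsLastArgmax.upper (nextR-isLastArgmax a<n)))
  ... | inj₁ xp≡0 = xp≡0
  ... | inj₂ (j , rj≡p , _) with rA n i A s j <? n
  ...   | yes rj<n = ⊥-elim (lastArgmax-not-inside (nextR-isLastArgmax a<n)
                       (subst (IsLastArgmax (S n i A s) _ n) rj≡p (nextR-isLastArgmax rj<n)) a<p p<b)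
  ...   | no rj≮n with () ← subst (a <_) (trans (sym rj≡p) (nextR-beyond (≮⇒≥ rj≮n))) a<p

  below-nextR≡sumZ : ∀ {a} → a < n → below n i A s (nextR n i A s a) ≡ sumZ i a (xA n i A s)
  below-nextR≡sumZ a<n =
    trans (below-skip (IsLastArgmax.lower (nextR-isLastArgmax a<n)) (xA-vanishes-inside a<n))
          (below≡sumℤ (suc _))

  S+sumZ+x<M : ∀ {a r x} → a < n → nextR n i A s a < r → r ≤ n →
               + 0 ℤ.≤ x → x ℤ.< xA n i A s (nextR n i A s a) →
               + S n i A s r ℤ.+ sumZ i a (xA n i A s) ℤ.+ x ℤ.< + M n i A s
  S+sumZ+x<M {a} {r} {x} a<n b<r r≤n 0≤x x<xb with xA-cases (<-≤-trans b<r r≤n)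
  ... | inj₁ xb≡0 = ⊥-elim (ℤ.<⇒≱ (subst (x ℤ.<_) xb≡0 x<xb) 0≤x)
  ... | inj₂ (_ , _ , xb≡) = r≤c∧x<m-c-z⇒r+z+x<m
    (ℤ.+≤+ (IsLastArgmax.maximal (nextR-isLastArgmax b<n) r b<r r≤n))
    (subst (λ z → x ℤ.< + M n i A s ℤ.- + S n i A s c ℤ.- z) (below-nextR≡sumZ a<n)
           (subst (x ℤ.<_) xb≡ x<xb))
    where
    b<n = <-≤-trans b<r r≤n
    c = nextR n i A s (nextR n i A s a)

  xA-nextR-beyond≤0 : ∀ {a} → 1 ≤ i → 1 ≤ n → n ≤ a → xA n i A s (nextR n i A s a) ℤ.≤ + 0
  xA-nextR-beyond≤0 {a} 1≤i 1≤n n≤a rewrite nextR-beyond n≤a with xA-cases 1≤n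
  ... | inj₁ x0≡0 = ℤ.≤-reflexive x0≡0
  ... | inj₂ (_ , _ , x0≡) =
    subst (ℤ._≤ + 0) (sym (trans x0≡ (ℤ.+-identityʳ _))) (ℤ.i≤j⇒i-j≤0 (ℤ.+≤+ M≤S))
    where
    M≤S : M n i A s ≤ S n i A s (nextR n i A s 0)
    M≤S = maxN-least (S n i A s) λ p i≤p p≤n →
      IsLastArgmax.maximal (nextR-isLastArgmax 1≤n) p (≤-trans 1≤i i≤p) p≤n

lemma2p3 : (n i m : ℕ) → 1 ≤ n → 1 ≤ i → i ≤ n → 1 ≤ m →
    (A : Arr) → InB n i m A →
    (s : ℕ) → 1 ≤ s → s < i →
    (k : ℕ) → 1 ≤ k → k < ℓA n i A s →
    (x : ℤ) → + 0 ℤ.≤ x → x ℤ.< xA n i A s (rA n i A s k) →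
    (r : ℕ) → rA n i A s k < r → r ≤ n →
    ((+ S n i A s r) ℤ.+ sumZ i (rA n i A s (k ∸ 1)) (xA n i A s)) ℤ.+ x
      ℤ.< + M n i A s
lemma2p3 n i m 1≤n 1≤i i≤n _ A _ s _ _ (suc k) _ _ x 0≤x x<xA r rk<r r≤n with rA n i A s k <? n
... | yes a<n = S+sumZ+x<M n i A s a<n rk<r r≤n 0≤x x<xA
-- k < ℓA rules this case out, but ℓA is computed by a private search; instead the junk value
-- r(s,k) = nextR _ = 0 gives x^A(s,0) ≤ 0, contradicting 0 ≤ x < x^A(s,r(s,k)).
... | no  a≮n =
  ⊥-elim (ℤ.<⇒≱ (ℤ.<-≤-trans x<xA (xA-nextR-beyond≤0 n i A s 1≤i 1≤n (≮⇒≥ a≮n))) 0≤x)
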